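{- There are no games $X,Y$ satisfying any of the following: (i) $X$ and $Y$ of type $\mathcal P$, $X+Y$ of type $\mathcal N$; (ii) $X$ of type $\mathcal O$, $Y$ of type $\mathcal P$, $X+Y$ of type $\mathcal P$; (iii) $X$ of type $\mathcal N$, $Y$ of type $\mathcal P$, $X+Y$ of type $\mathcal O$.
   Context: A (finite impartial) game is defined recursively as a finite set of games, its options; $0$ is the game with no options. Three players alternate moves cyclically; a move replaces the current game by one of its options, and the player who makes the last move wins. The disjunctive sum $G+H$ is the game whose options are all $G'+H$ ($G'$ an option of $G$) and all $G+H'$ ($H'$ an option of $H$). Types are defined recursively: $G$ is of type $\mathcal N$ iff it has some option of type $\mathcal P$; of type $\mathcal O$ iff it has at least one option and all its options are of type $\mathcal N$; of type $\mathcal P$ iff all its options are of type $\mathcal O$ (so $0$ is of type $\mathcal P$); of type $\mathcal Q$ otherwise. -}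

module Defs where

open import Data.List using (List; []; _∷_; _++_)
open import Data.Bool using (Bool; true; false; _∧_; _∨_; if_then_else_)

-- A finite impartial game: given by its (finite) list of options.
-- (Order/duplicates in the list are irrelevant to everything below.)
data Game : Set where
  node : List Game → Game

zeroG : Game
zeroG = node []

-- The four types of three-player games
data GameType : Set where
  𝒩 𝒪 𝒫 𝒬 : GameType

isN isO isP : GameType → Bool
isN 𝒩 = true
isN _ = false
isO 𝒪 = true
isO _ = false
isP 𝒫 = true
isP _ = false

anyB allB : (GameType → Bool) → List GameType → Bool
anyB f [] = false
anyB f (t ∷ ts) = f t ∨ anyB f ts
allB f [] = true
allB f (t ∷ ts) = f t ∧ allB f ts

nonEmpty : List GameType → Bool
nonEmpty [] = false
nonEmpty (_ ∷ _) = true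

classify : List GameType → GameType
classify ts =
  if anyB isP ts then 𝒩
  else if nonEmpty ts ∧ allB isN ts then 𝒪
  else if allB isO ts then 𝒫
  else 𝒬

mutual
  typeOf : Game → GameType
  typeOf (node gs) = classify (typesOf gs)

  typesOf : List Game → List GameType
  typesOf [] = []
  typesOf (g ∷ gs) = typeOf g ∷ typesOf gs

mutual
  _⊕_ : Game → Game → Game
  x@(node gs) ⊕ y@(node hs) = node (sumL gs y ++ sumR x hs)

  sumL : List Game → Game → List Game
  sumL [] h = []
  sumL (g ∷ gs) h = (g ⊕ h) ∷ sumL gs h

  sumR : Game → List Game → List Game
  sumR g [] = []
  sumR g (h ∷ hs) = (g ⊕ h) ∷ sumR g hs

{-# OPTIONS --safe #-}
-- Each of the three configurations forces another one a move lower. If X, Y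
-- are 𝒫 and X + Y is 𝒩, its 𝒫-option X′ + Y has X′ of type 𝒪, as in (ii). In
-- (ii) an 𝒩-option X′ of X makes X′ + Y an option of the 𝒫-game X + Y, hence
-- of type 𝒪, as in (iii). In (iii) a 𝒫-option X′ of X makes X′ + Y an option
-- of the 𝒪-game X + Y, hence of type 𝒩, as in (i). Since the move in X + Y may
-- be made in Y, the mirror images of (ii) and (iii) join the cycle, and
-- induction on the pair (X, Y) rules out all five configurations.
module Submission where

open import Defs
open import Data.Bool using (true; false; _∧_)
open import Data.Bool.Properties using (∧-conicalˡ; ∧-conicalʳ)
open import Data.List using (List; []; _∷_; _++_; map)
open import Data.List.Relation.Unary.Any as Any using (Any; here; there)
open import Data.List.Relation.Unary.All as All using (All; []; _∷_)
import Data.List.Relation.Unary.Any.Properties as Any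
import Data.List.Relation.Unary.All.Properties as All
open import Data.List.Membership.Propositional using (_∈_; find)
open import Data.List.Membership.Propositional.Properties
  using (∈-map⁺; ∈-map⁻; ∈-++⁺ˡ; ∈-++⁺ʳ; ∈-++⁻)
open import Data.Product using (_×_; _,_; proj₁; proj₂; ∃-syntax)
open import Data.Sum as Sum using (_⊎_; inj₁; inj₂; [_,_])
open import Data.Unit using (⊤)
open import Level using (Level)
open import Relation.Nullary using (¬_)
open import Relation.Binary.PropositionalEquality
  using (_≡_; refl; sym; trans; cong; cong₂; subst)

private
  variable
    ℓ : Level
    X′ Y′ Z : Game
    t : GameType

options : Game → List Game
options (node gs) = gs

game-pair-induction : (P : Game → Game → Set ℓ) →
  (∀ X Y → (∀ {X′} → X′ ∈ options X → P X′ Y) →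
           (∀ {Y′} → Y′ ∈ options Y → P X Y′) → P X Y) →
  ∀ X Y → P X Y
game-pair-induction P step = induction
  where
  induction : ∀ X Y → P X Y
  belowˡ : ∀ xs Y → ∀ {X′} → X′ ∈ xs → P X′ Y
  belowʳ : ∀ X ys → ∀ {Y′} → Y′ ∈ ys → P X Y′

  induction X@(node xs) Y@(node ys) = step X Y (belowˡ xs Y) (belowʳ X ys)

  belowˡ (x ∷ xs) Y (here refl) = induction x Y
  belowˡ (x ∷ xs) Y (there m)   = belowˡ xs Y m

  belowʳ X (y ∷ ys) (here refl) = induction X y
  belowʳ X (y ∷ ys) (there m)   = belowʳ X ys m

sumL≡map : ∀ gs Y → sumL gs Y ≡ map (_⊕ Y) gs
sumL≡map []       Y = refl
sumL≡map (g ∷ gs) Y = cong (g ⊕ Y ∷_) (sumL≡map gs Y)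

sumR≡map : ∀ X hs → sumR X hs ≡ map (X ⊕_) hs
sumR≡map X []       = refl
sumR≡map X (h ∷ hs) = cong (X ⊕ h ∷_) (sumR≡map X hs)

options-⊕ : ∀ X Y → options (X ⊕ Y) ≡ map (_⊕ Y) (options X) ++ map (X ⊕_) (options Y)
options-⊕ X@(node gs) Y@(node hs) = cong₂ _++_ (sumL≡map gs Y) (sumR≡map X hs)

option-⊕⁺ˡ : ∀ X Y → X′ ∈ options X → X′ ⊕ Y ∈ options (X ⊕ Y)
option-⊕⁺ˡ X Y m =
  subst (_ ∈_) (sym (options-⊕ X Y)) (∈-++⁺ˡ (∈-map⁺ (_⊕ Y) m))

option-⊕⁺ʳ : ∀ X Y → Y′ ∈ options Y → X ⊕ Y′ ∈ options (X ⊕ Y)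
option-⊕⁺ʳ X Y m =
  subst (_ ∈_) (sym (options-⊕ X Y)) (∈-++⁺ʳ (map (_⊕ Y) (options X)) (∈-map⁺ (X ⊕_) m))

option-⊕⁻ : ∀ X Y → Z ∈ options (X ⊕ Y) →
  (∃[ X′ ] X′ ∈ options X × Z ≡ X′ ⊕ Y) ⊎ (∃[ Y′ ] Y′ ∈ options Y × Z ≡ X ⊕ Y′)
option-⊕⁻ X Y m =
  Sum.map (∈-map⁻ (_⊕ Y)) (∈-map⁻ (X ⊕_))
    (∈-++⁻ (map (_⊕ Y) (options X)) (subst (_ ∈_) (options-⊕ X Y) m))

isN-sound : isN t ≡ true → t ≡ 𝒩
isN-sound {𝒩} _ = refl

isO-sound : isO t ≡ true → t ≡ 𝒪
isO-sound {𝒪} _ = refl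

isP-sound : isP t ≡ true → t ≡ 𝒫
isP-sound {𝒫} _ = refl

anyB-sound : ∀ {f} ts → anyB f ts ≡ true → Any (λ t → f t ≡ true) ts
anyB-sound {f} (t ∷ ts) e with f t in ft
... | true  = here ft
... | false = there (anyB-sound ts e)

allB-sound : ∀ {f} ts → allB f ts ≡ true → All (λ t → f t ≡ true) ts
allB-sound []           _ = []
allB-sound {f} (t ∷ ts) e = ∧-conicalˡ (f t) _ e ∷ allB-sound ts (∧-conicalʳ (f t) _ e)

nonEmpty-All⇒Any : ∀ {P : GameType → Set} {ts} → nonEmpty ts ≡ true → All P ts → Any P ts
nonEmpty-All⇒Any {ts = _ ∷ _} _ (p ∷ _) = here p

OptionTypes : GameType → List GameType → Set
OptionTypes 𝒩 ts = Any (_≡ 𝒫) ts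
OptionTypes 𝒪 ts = Any (_≡ 𝒩) ts × All (_≡ 𝒩) ts
OptionTypes 𝒫 ts = All (_≡ 𝒪) ts
OptionTypes 𝒬 ts = ⊤

classify-sound : ∀ ts → OptionTypes (classify ts) ts
classify-sound ts with anyB isP ts in p | nonEmpty ts ∧ allB isN ts in q | allB isO ts in r
... | true  | _     | _     = Any.map isP-sound (anyB-sound ts p)
... | false | true  | _     =
  let all𝒩 = All.map isN-sound (allB-sound ts (∧-conicalʳ _ _ q))
  in  nonEmpty-All⇒Any (∧-conicalˡ _ _ q) all𝒩 , all𝒩
... | false | false | true  = All.map isO-sound (allB-sound ts r)
... | false | false | false = _

typesOf≡map : ∀ gs → typesOf gs ≡ map typeOf gs
typesOf≡map []       = refl
typesOf≡map (g ∷ gs) = cong (typeOf g ∷_) (typesOf≡map gs)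

typeOf≡classify : ∀ X → typeOf X ≡ classify (map typeOf (options X))
typeOf≡classify (node gs) = cong classify (typesOf≡map gs)

typeOf-sound : ∀ X → typeOf X ≡ t → OptionTypes t (map typeOf (options X))
typeOf-sound X e =
  subst (λ t → OptionTypes t (map typeOf (options X)))
        (trans (sym (typeOf≡classify X)) e) (classify-sound _)

𝒩⇒𝒫-option : ∀ X → typeOf X ≡ 𝒩 → ∃[ X′ ] X′ ∈ options X × typeOf X′ ≡ 𝒫
𝒩⇒𝒫-option X e = find (Any.map⁻ (typeOf-sound X e))

𝒪⇒𝒩-option : ∀ X → typeOf X ≡ 𝒪 → ∃[ X′ ] X′ ∈ options X × typeOf X′ ≡ 𝒩
𝒪⇒𝒩-option X e = find (Any.map⁻ (proj₁ (typeOf-sound X e)))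

𝒪⇒options-𝒩 : ∀ X → typeOf X ≡ 𝒪 → X′ ∈ options X → typeOf X′ ≡ 𝒩
𝒪⇒options-𝒩 X e = All.lookup (All.map⁻ (proj₂ (typeOf-sound X e)))

𝒫⇒options-𝒪 : ∀ X → typeOf X ≡ 𝒫 → X′ ∈ options X → typeOf X′ ≡ 𝒪
𝒫⇒options-𝒪 X e = All.lookup (All.map⁻ (typeOf-sound X e))

data Forbidden (X Y : Game) : Set where
  𝒫+𝒫=𝒩 : typeOf X ≡ 𝒫 → typeOf Y ≡ 𝒫 → typeOf (X ⊕ Y) ≡ 𝒩 → Forbidden X Y
  𝒪+𝒫=𝒫 : typeOf X ≡ 𝒪 → typeOf Y ≡ 𝒫 → typeOf (X ⊕ Y) ≡ 𝒫 → Forbidden X Y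
  𝒫+𝒪=𝒫 : typeOf X ≡ 𝒫 → typeOf Y ≡ 𝒪 → typeOf (X ⊕ Y) ≡ 𝒫 → Forbidden X Y
  𝒩+𝒫=𝒪 : typeOf X ≡ 𝒩 → typeOf Y ≡ 𝒫 → typeOf (X ⊕ Y) ≡ 𝒪 → Forbidden X Y
  𝒫+𝒩=𝒪 : typeOf X ≡ 𝒫 → typeOf Y ≡ 𝒩 → typeOf (X ⊕ Y) ≡ 𝒪 → Forbidden X Y

Forbidden-descent : ∀ {X Y} → Forbidden X Y →
  (∃[ X′ ] X′ ∈ options X × Forbidden X′ Y) ⊎ (∃[ Y′ ] Y′ ∈ options Y × Forbidden X Y′)
Forbidden-descent {X} {Y} (𝒫+𝒫=𝒩 x y s) with 𝒩⇒𝒫-option (X ⊕ Y) s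
... | _ , m , z with option-⊕⁻ X Y m
...   | inj₁ (X′ , m′ , refl) = inj₁ (X′ , m′ , 𝒪+𝒫=𝒫 (𝒫⇒options-𝒪 X x m′) y z)
...   | inj₂ (Y′ , m′ , refl) = inj₂ (Y′ , m′ , 𝒫+𝒪=𝒫 x (𝒫⇒options-𝒪 Y y m′) z)
Forbidden-descent {X} {Y} (𝒪+𝒫=𝒫 x y s) =
  let X′ , m , x′ = 𝒪⇒𝒩-option X x
  in  inj₁ (X′ , m , 𝒩+𝒫=𝒪 x′ y (𝒫⇒options-𝒪 (X ⊕ Y) s (option-⊕⁺ˡ X Y m)))
Forbidden-descent {X} {Y} (𝒫+𝒪=𝒫 x y s) =
  let Y′ , m , y′ = 𝒪⇒𝒩-option Y y
  in  inj₂ (Y′ , m , 𝒫+𝒩=𝒪 x y′ (𝒫⇒options-𝒪 (X ⊕ Y) s (option-⊕⁺ʳ X Y m)))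
Forbidden-descent {X} {Y} (𝒩+𝒫=𝒪 x y s) =
  let X′ , m , x′ = 𝒩⇒𝒫-option X x
  in  inj₁ (X′ , m , 𝒫+𝒫=𝒩 x′ y (𝒪⇒options-𝒩 (X ⊕ Y) s (option-⊕⁺ˡ X Y m)))
Forbidden-descent {X} {Y} (𝒫+𝒩=𝒪 x y s) =
  let Y′ , m , y′ = 𝒩⇒𝒫-option Y y
  in  inj₂ (Y′ , m , 𝒫+𝒫=𝒩 x y′ (𝒪⇒options-𝒩 (X ⊕ Y) s (option-⊕⁺ʳ X Y m)))

¬Forbidden : ∀ X Y → ¬ Forbidden X Y
¬Forbidden = game-pair-induction (λ X Y → ¬ Forbidden X Y) λ X Y ihˡ ihʳ f →
  [ (λ { (_ , m , f′) → ihˡ m f′ }) , (λ { (_ , m , f′) → ihʳ m f′ }) ] (Forbidden-descent f)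

claim2 : (X Y : Game) →
    ¬ ((typeOf X ≡ 𝒫 × typeOf Y ≡ 𝒫 × typeOf (X ⊕ Y) ≡ 𝒩)
       ⊎ (typeOf X ≡ 𝒪 × typeOf Y ≡ 𝒫 × typeOf (X ⊕ Y) ≡ 𝒫)
       ⊎ (typeOf X ≡ 𝒩 × typeOf Y ≡ 𝒫 × typeOf (X ⊕ Y) ≡ 𝒪))
claim2 X Y (inj₁ (x , y , s))        = ¬Forbidden X Y (𝒫+𝒫=𝒩 x y s)
claim2 X Y (inj₂ (inj₁ (x , y , s))) = ¬Forbidden X Y (𝒪+𝒫=𝒫 x y s)
claim2 X Y (inj₂ (inj₂ (x , y , s))) = ¬Forbidden X Y (𝒩+𝒫=𝒪 x y s)
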